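{- Let $P$ be a $0/1$-polytope. Then $\operatorname{xc}^*(P) \leq \#\mathrm{facets}(P)$ and $\operatorname{xc}^*(P) \leq \#\mathrm{vertices}(P)$.
   Context: A $0/1$-polytope is a polytope all of whose vertices lie in $\{0,1\}^p$ for some $p$. For a polytope $P \subseteq \mathbb{R}^p$, an extension of $P$ is a pair $(Q,\pi)$ where $Q \subseteq \mathbb{R}^q$ is a polyhedron and $\pi\colon \mathbb{R}^q \to \mathbb{R}^p$ is a linear map with $\pi(Q) = P$; its size is the number of facets of $Q$. An extension $(Q,\pi)$ of a $0/1$-polytope $P$ is a nice $0/1$-extension if (i) $Q$ is a $0/1$-polytope, (ii) each vertex of $Q$ is mapped by $\pi$ onto a vertex of $P$, and (iii) for each vertex $v$ of $P$ there is exactly one vertex of $Q$ mapped onto $v$. $\operatorname{xc}^*(P)$ denotes the smallest size of any nice $0/1$-extension of $P$. $\#\mathrm{facets}(P)$ and $\#\mathrm{vertices}(P)$ denote the numbers of facets and vertices of $P$. -}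

module Defs where

open import Data.Nat using (ℕ; zero; suc)
open import Data.Fin using (Fin; zero; suc)
open import Data.Rational using (ℚ; 0ℚ; 1ℚ; _+_; _*_; _≤_)
open import Data.Bool using (Bool; true; false)
open import Data.Vec using (Vec)
import Data.Vec as Vec
open import Data.List using (List; length)
import Data.List as List
open import Data.List.Relation.Unary.Unique.Propositional using (Unique)
import Data.List.Membership.Propositional as LMem
open import Data.Fin.Subset using (Subset; ⊤; _⊆_)
import Data.Fin.Subset as Sub
open import Data.Product using (Σ; ∃; _×_)
open import Relation.Binary.PropositionalEquality using (_≡_; _≢_)

Σᶠ : ∀ {n} → (Fin n → ℚ) → ℚ
Σᶠ {zero}  f = 0ℚ
Σᶠ {suc n} f = f zero + Σᶠ (λ i → f (suc i))

Point : ℕ → Set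
Point p = Fin p → ℚ

_≗ₚ_ : ∀ {p} → Point p → Point p → Set
x ≗ₚ y = ∀ i → x i ≡ y i

_·_ : ∀ {p} → Point p → Point p → ℚ
x · y = Σᶠ (λ i → x i * y i)

bool→ℚ : Bool → ℚ
bool→ℚ true  = 1ℚ
bool→ℚ false = 0ℚ

embed : ∀ {p} → Vec Bool p → Point p
embed v i = bool→ℚ (Vec.lookup v i)

-- A 0/1-polytope in ℚ^p, given by its (distinct) vertices: P = conv(verts).
-- (Every point of a finite subset of {0,1}^p is a vertex of its convex hull,
-- so verts is exactly the vertex set of P.)
record ZeroOnePolytope (p : ℕ) : Set where
  field
    verts    : List (Vec Bool p)
    distinct : Unique verts

open ZeroOnePolytope public

#vertices : ∀ {p} → ZeroOnePolytope p → ℕ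
#vertices P = length (verts P)

vtx : ∀ {p} (P : ZeroOnePolytope p) → Fin (#vertices P) → Point p
vtx P i = embed (List.lookup (verts P) i)

InPoly : ∀ {p} → ZeroOnePolytope p → Point p → Set
InPoly P x = Σ (Fin (#vertices P) → ℚ) λ w →
  (∀ i → 0ℚ ≤ w i) × (Σᶠ w ≡ 1ℚ) ×
  (∀ j → Σᶠ (λ i → w i * vtx P i j) ≡ x j)

-- Faces of P, identified with their vertex sets (a subset of the vertex indices):
-- F is a face iff F = {v ∈ verts : c·v = δ} for a valid inequality c·x ≤ δ.
-- (Includes the empty face and P itself.)
IsFace : ∀ {p} (P : ZeroOnePolytope p) → Subset (#vertices P) → Set
IsFace {p} P F = Σ (Point p) λ c → Σ ℚ λ δ →
  (∀ i → (c · vtx P i) ≤ δ) ×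
  (∀ i → (i Sub.∈ F → (c · vtx P i) ≡ δ) × ((c · vtx P i) ≡ δ → i Sub.∈ F))

IsFacet : ∀ {p} (P : ZeroOnePolytope p) → Subset (#vertices P) → Set
IsFacet P F = IsFace P F × F ≢ ⊤ ×
  (∀ G → IsFace P G → G ≢ ⊤ → F ⊆ G → G ≡ F)

FacetCount : ∀ {p} → ZeroOnePolytope p → ℕ → Set
FacetCount P k = Σ (List (Subset (#vertices P))) λ L →
  Unique L × (∀ F → (IsFacet P F → F LMem.∈ L) × (F LMem.∈ L → IsFacet P F)) ×
  length L ≡ k

Matrix : ℕ → ℕ → Set
Matrix p q = Fin p → Fin q → ℚ

apply : ∀ {p q} → Matrix p q → Point q → Point p
apply π y i = Σᶠ (λ j → π i j * y j)

-- (Q, π) is a nice 0/1-extension of P (Q is a 0/1-polytope by its type):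
NiceExt : ∀ {p q} → ZeroOnePolytope p → ZeroOnePolytope q → Matrix p q → Set
NiceExt P Q π =
  (∀ x → (InPoly P x → Σ (Point _) λ y → InPoly Q y × apply π y ≗ₚ x)
       × ((Σ (Point _) λ y → InPoly Q y × apply π y ≗ₚ x) → InPoly P x)) ×
  (∀ j → Σ (Fin (#vertices P)) λ i → apply π (vtx Q j) ≗ₚ vtx P i) ×
  (∀ i → Σ (Fin (#vertices Q)) λ j → (apply π (vtx Q j) ≗ₚ vtx P i) ×
         (∀ j′ → apply π (vtx Q j′) ≗ₚ vtx P i → j′ ≡ j))

module Submission where

-- Both bounds are witnessed by explicit nice 0/1-extensions.
--
-- (a) xc*(P) ≤ #facets(P): P is a nice extension of itself via the identity map.
-- (b) xc*(P) ≤ #vertices(P): with n = #vertices(P), let Q be the standard simplex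
--     Δₙ = conv(e₁,…,eₙ) ⊆ ℚⁿ and π the matrix whose columns are the vertices of P.
--     Then π(eₐ) is the a-th vertex of P, and Δₙ has exactly n facets
--     {x ∈ Δₙ : xₐ = 0}.
--
-- Both constructions are instances of one general fact: if a linear map sends the
-- vertices of Q bijectively onto the vertices of P, then (Q, π) is a nice extension,
-- because convex weights on the vertices can be transported along the bijection.

open import Defs
open import Data.Nat using (ℕ; _≤_)
import Data.Nat.Properties as ℕP
open import Data.Bool using (Bool)
open import Data.Fin using (Fin; zero; suc; cast)
open import Data.Fin.Properties using (_≟_; cast-involutive)
open import Data.Fin.Permutation using (permutation)
open import Data.Fin.Subset using (Subset; ⊤; _⊆_; _∈_; _∉_; ∁; ⁅_⁆)
open import Data.Fin.Subset.Properties
  using (nonempty?; ∈⊤; ⊆⊤; ⊆-antisym; x≢y⇒x∉⁅y⁆; x∉⁅y⁆⇒x≢y; x∉p⇒x∈∁p; x∈∁p⇒x∉p; x∉∁p⇒x∈p)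
open import Data.Rational using (ℚ; 0ℚ; 1ℚ; _+_; _*_; -_) renaming (_≤_ to _≤ℚ_)
import Data.Rational.Properties as ℚP
open import Data.Vec using (Vec)
import Data.Vec as Vec
open import Data.Vec.Properties using (lookup∘tabulate; tabulate∘lookup; tabulate-cong)
open import Data.List using (List)
import Data.List as List
open import Data.List.Properties using (length-tabulate; lookup-tabulate)
import Data.List.Relation.Unary.All as All
open import Data.List.Relation.Unary.AllPairs using (_∷_)
open import Data.List.Relation.Unary.Unique.Propositional using (Unique)
open import Data.List.Relation.Unary.Unique.Propositional.Properties using (tabulate⁺)
open import Data.List.Membership.Propositional using () renaming (_∈_ to _∈ₗ_)
open import Data.List.Membership.Propositional.Properties using (∈-lookup; ∈-tabulate⁺; ∈-tabulate⁻)
open import Data.Product using (Σ; ∃; _×_; _,_)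
open import Data.Empty using (⊥-elim)
open import Algebra.Bundles using (CommutativeRing)
import Algebra.Properties.Semiring.Sum as SemiringSum
import Algebra.Properties.CommutativeSemigroup as CommutativeSemigroupProperties
open import Function using (id; _∘_)
open import Relation.Nullary using (does; yes; no)
open import Relation.Nullary.Decidable using (dec-true; dec-false; from-yes)
open import Relation.Binary.PropositionalEquality

open CommutativeRing ℚP.+-*-commutativeRing using (semiring; *-commutativeSemigroup)
module ℚΣ = SemiringSum semiring
open CommutativeSemigroupProperties *-commutativeSemigroup using (x∙yz≈y∙xz)

-- Σᶠ is the library's semiring sum over ℚ, so its algebra can be imported.
Σᶠ≡sum : ∀ {n} (f : Fin n → ℚ) → Σᶠ f ≡ ℚΣ.sum f
Σᶠ≡sum {ℕ.zero}  f = refl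
Σᶠ≡sum {ℕ.suc n} f = cong (f zero +_) (Σᶠ≡sum (λ i → f (suc i)))

Σᶠ-cong : ∀ {n} {f g : Fin n → ℚ} → (∀ i → f i ≡ g i) → Σᶠ f ≡ Σᶠ g
Σᶠ-cong {ℕ.zero}  f≗g = refl
Σᶠ-cong {ℕ.suc n} f≗g = cong₂ _+_ (f≗g zero) (Σᶠ-cong (λ i → f≗g (suc i)))

*-distribˡ-Σᶠ : ∀ {n} x (f : Fin n → ℚ) → x * Σᶠ f ≡ Σᶠ (λ i → x * f i)
*-distribˡ-Σᶠ x f = begin
  x * Σᶠ f                 ≡⟨ cong (x *_) (Σᶠ≡sum f) ⟩
  x * ℚΣ.sum f             ≡⟨ ℚΣ.*-distribˡ-sum x f ⟩
  ℚΣ.sum (λ i → x * f i)   ≡⟨ Σᶠ≡sum (λ i → x * f i) ⟨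
  Σᶠ (λ i → x * f i)       ∎
  where open ≡-Reasoning

*-distribʳ-Σᶠ : ∀ {n} x (f : Fin n → ℚ) → Σᶠ f * x ≡ Σᶠ (λ i → f i * x)
*-distribʳ-Σᶠ x f = begin
  Σᶠ f * x                 ≡⟨ cong (_* x) (Σᶠ≡sum f) ⟩
  ℚΣ.sum f * x             ≡⟨ ℚΣ.*-distribʳ-sum x f ⟩
  ℚΣ.sum (λ i → f i * x)   ≡⟨ Σᶠ≡sum (λ i → f i * x) ⟨
  Σᶠ (λ i → f i * x)       ∎
  where open ≡-Reasoning

Σᶠ-swap : ∀ {m n} (f : Fin m → Fin n → ℚ) →
  Σᶠ (λ i → Σᶠ (λ j → f i j)) ≡ Σᶠ (λ j → Σᶠ (λ i → f i j))
Σᶠ-swap f = begin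
  Σᶠ (λ i → Σᶠ (λ j → f i j))          ≡⟨ Σᶠ≡sum (λ i → Σᶠ (f i)) ⟩
  ℚΣ.sum (λ i → Σᶠ (λ j → f i j))      ≡⟨ ℚΣ.sum-cong-≗ (λ i → Σᶠ≡sum (f i)) ⟩
  ℚΣ.sum (λ i → ℚΣ.sum (f i))          ≡⟨ ℚΣ.∑-comm f ⟩
  ℚΣ.sum (λ j → ℚΣ.sum (λ i → f i j))  ≡⟨ ℚΣ.sum-cong-≗ (λ j → Σᶠ≡sum (λ i → f i j)) ⟨
  ℚΣ.sum (λ j → Σᶠ (λ i → f i j))      ≡⟨ Σᶠ≡sum (λ j → Σᶠ (λ i → f i j)) ⟨
  Σᶠ (λ j → Σᶠ (λ i → f i j))          ∎
  where open ≡-Reasoning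

Σᶠ-reindex : ∀ {m n} (σ : Fin m → Fin n) (τ : Fin n → Fin m) →
  (∀ i → σ (τ i) ≡ i) → (∀ j → τ (σ j) ≡ j) →
  ∀ f → Σᶠ (λ j → f (σ j)) ≡ Σᶠ f
Σᶠ-reindex σ τ σ∘τ τ∘σ f = begin
  Σᶠ (λ j → f (σ j))      ≡⟨ Σᶠ≡sum (λ j → f (σ j)) ⟩
  ℚΣ.sum (λ j → f (σ j))  ≡⟨ ℚΣ.∑-permute f (permutation σ τ σ∘τ τ∘σ) ⟨
  ℚΣ.sum f                ≡⟨ Σᶠ≡sum f ⟨
  Σᶠ f                    ∎
  where open ≡-Reasoning

δ : ∀ {n} → Fin n → Fin n → ℚ
δ a k = bool→ℚ (does (a ≟ k))

δ-diag : ∀ {n} (a : Fin n) → δ a a ≡ 1ℚ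
δ-diag a = cong bool→ℚ (dec-true (a ≟ a) refl)

δ-off : ∀ {n} {a b : Fin n} → a ≢ b → δ a b ≡ 0ℚ
δ-off {a = a} {b} a≢b = cong bool→ℚ (dec-false (a ≟ b) a≢b)

Σᶠ-δ : ∀ {n} (f : Fin n → ℚ) (a : Fin n) → Σᶠ (λ k → f k * δ a k) ≡ f a
Σᶠ-δ f zero = begin
  f zero * 1ℚ + Σᶠ (λ k → f (suc k) * 0ℚ)  ≡⟨ cong₂ _+_ (ℚP.*-identityʳ (f zero)) rest≡0 ⟩
  f zero + 0ℚ                              ≡⟨ ℚP.+-identityʳ (f zero) ⟩
  f zero                                   ∎
  where
  open ≡-Reasoning
  rest≡0 : Σᶠ (λ k → f (suc k) * 0ℚ) ≡ 0ℚ
  rest≡0 = trans (sym (*-distribʳ-Σᶠ 0ℚ (f ∘ suc))) (ℚP.*-zeroʳ (Σᶠ (f ∘ suc)))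
Σᶠ-δ f (suc a) = begin
  f zero * 0ℚ + Σᶠ (λ k → f (suc k) * δ a k)  ≡⟨ cong₂ _+_ (ℚP.*-zeroʳ (f zero)) (Σᶠ-δ (f ∘ suc) a) ⟩
  0ℚ + f (suc a)                              ≡⟨ ℚP.+-identityˡ (f (suc a)) ⟩
  f (suc a)                                   ∎
  where open ≡-Reasoning

apply-combination : ∀ {p q m} (π : Matrix p q) (w : Fin m → ℚ) (u : Fin m → Point q) (y : Point q) →
  (∀ k → Σᶠ (λ j → w j * u j k) ≡ y k) →
  ∀ r → apply π y r ≡ Σᶠ (λ j → w j * apply π (u j) r)
apply-combination π w u y y≡Σwu r = begin
  Σᶠ (λ k → π r k * y k)                       ≡⟨ Σᶠ-cong (λ k → cong (π r k *_) (sym (y≡Σwu k))) ⟩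
  Σᶠ (λ k → π r k * Σᶠ (λ j → w j * u j k))    ≡⟨ Σᶠ-cong (λ k → *-distribˡ-Σᶠ (π r k) (λ j → w j * u j k)) ⟩
  Σᶠ (λ k → Σᶠ (λ j → π r k * (w j * u j k)))  ≡⟨ Σᶠ-swap (λ k j → π r k * (w j * u j k)) ⟩
  Σᶠ (λ j → Σᶠ (λ k → π r k * (w j * u j k)))  ≡⟨ Σᶠ-cong (λ j → Σᶠ-cong (λ k → x∙yz≈y∙xz (π r k) (w j) (u j k))) ⟩
  Σᶠ (λ j → Σᶠ (λ k → w j * (π r k * u j k)))  ≡⟨ Σᶠ-cong (λ j → *-distribˡ-Σᶠ (w j) (λ k → π r k * u j k)) ⟨
  Σᶠ (λ j → w j * apply π (u j) r)             ∎
  where open ≡-Reasoning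

identityMatrix : ∀ {p} → Matrix p p
identityMatrix = δ

apply-identity : ∀ {p} (y : Point p) → apply identityMatrix y ≗ₚ y
apply-identity y r = trans (Σᶠ-cong (λ j → ℚP.*-comm (δ r j) (y j))) (Σᶠ-δ y r)

bool→ℚ-injective : ∀ {a b} → bool→ℚ a ≡ bool→ℚ b → a ≡ b
bool→ℚ-injective {Bool.true}  {Bool.true}  _ = refl
bool→ℚ-injective {Bool.false} {Bool.false} _ = refl

embed-injective : ∀ {p} {u v : Vec Bool p} → embed u ≗ₚ embed v → u ≡ v
embed-injective {u = u} {v} u≗v = begin
  u                           ≡⟨ tabulate∘lookup u ⟨
  Vec.tabulate (Vec.lookup u) ≡⟨ tabulate-cong (λ i → bool→ℚ-injective (u≗v i)) ⟩
  Vec.tabulate (Vec.lookup v) ≡⟨ tabulate∘lookup v ⟩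
  v                           ∎
  where open ≡-Reasoning

lookup-injective : ∀ {A : Set} {xs : List A} → Unique xs →
  ∀ i j → List.lookup xs i ≡ List.lookup xs j → i ≡ j
lookup-injective (_ ∷ _) zero zero _ = refl
lookup-injective (x≢xs ∷ _) zero (suc j) x≡ = ⊥-elim (All.lookup x≢xs (∈-lookup j) x≡)
lookup-injective (x≢xs ∷ _) (suc i) zero ≡x = ⊥-elim (All.lookup x≢xs (∈-lookup i) (sym ≡x))
lookup-injective (_ ∷ xs!) (suc i) (suc j) eq = cong suc (lookup-injective xs! i j eq)

vtx-injective : ∀ {p} (P : ZeroOnePolytope p) {i j} → vtx P i ≗ₚ vtx P j → i ≡ j
vtx-injective P {i} {j} vi≗vj = lookup-injective (distinct P) i j (embed-injective vi≗vj)

record VertexBijection {p q} (P : ZeroOnePolytope p) (Q : ZeroOnePolytope q) (π : Matrix p q) : Set where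
  field
    σ             : Fin (#vertices Q) → Fin (#vertices P)
    τ             : Fin (#vertices P) → Fin (#vertices Q)
    σ∘τ           : ∀ i → σ (τ i) ≡ i
    τ∘σ           : ∀ j → τ (σ j) ≡ j
    maps-vertices : ∀ j → apply π (vtx Q j) ≗ₚ vtx P (σ j)

-- A vertex bijection makes (Q, π) a nice extension: a point of Q with weights w
-- maps to the point of P with weights w ∘ τ, and conversely with weights w ∘ σ.
vertexBijection⇒nice : ∀ {p q} {P : ZeroOnePolytope p} {Q : ZeroOnePolytope q} {π : Matrix p q} →
  VertexBijection P Q π → NiceExt P Q π
vertexBijection⇒nice {q = q} {P} {Q} {π} bij =
  (λ x → lift x , descend x) , (λ j → σ j , maps-vertices j) , uniquePreimage
  where
  open VertexBijection bij
  open ≡-Reasoning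

  image : ∀ w y → (∀ k → Σᶠ (λ j → w j * vtx Q j k) ≡ y k) →
    ∀ r → apply π y r ≡ Σᶠ (λ j → w j * vtx P (σ j) r)
  image w y y≡Σ r =
    trans (apply-combination π w (vtx Q) y y≡Σ r) (Σᶠ-cong (λ j → cong (w j *_) (maps-vertices j r)))

  lift : ∀ x → InPoly P x → Σ (Point q) λ y → InPoly Q y × apply π y ≗ₚ x
  lift x (w , w≥0 , Σw≡1 , Σwv≡x) =
    y , (w ∘ σ , w≥0 ∘ σ , trans (Σᶠ-reindex σ τ σ∘τ τ∘σ w) Σw≡1 , λ _ → refl) , πy≡x
    where
    y : Point q
    y k = Σᶠ (λ j → w (σ j) * vtx Q j k)
    πy≡x : apply π y ≗ₚ x
    πy≡x r = begin
      apply π y r                         ≡⟨ image (w ∘ σ) y (λ _ → refl) r ⟩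
      Σᶠ (λ j → w (σ j) * vtx P (σ j) r)  ≡⟨ Σᶠ-reindex σ τ σ∘τ τ∘σ (λ i → w i * vtx P i r) ⟩
      Σᶠ (λ i → w i * vtx P i r)          ≡⟨ Σwv≡x r ⟩
      x r                                 ∎

  descend : ∀ x → (Σ (Point q) λ y → InPoly Q y × apply π y ≗ₚ x) → InPoly P x
  descend x (y , (w , w≥0 , Σw≡1 , Σwv≡y) , πy≡x) =
    w ∘ τ , w≥0 ∘ τ , trans (Σᶠ-reindex τ σ τ∘σ σ∘τ w) Σw≡1 , Σwv≡x
    where
    Σwv≡x : ∀ r → Σᶠ (λ i → w (τ i) * vtx P i r) ≡ x r
    Σwv≡x r = begin
      Σᶠ (λ i → w (τ i) * vtx P i r)          ≡⟨ Σᶠ-cong (λ i → cong (λ i′ → w (τ i) * vtx P i′ r) (σ∘τ i)) ⟨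
      Σᶠ (λ i → w (τ i) * vtx P (σ (τ i)) r)  ≡⟨ Σᶠ-reindex τ σ τ∘σ σ∘τ (λ j → w j * vtx P (σ j) r) ⟩
      Σᶠ (λ j → w j * vtx P (σ j) r)          ≡⟨ image w y Σwv≡y r ⟨
      apply π y r                             ≡⟨ πy≡x r ⟩
      x r                                     ∎

  uniquePreimage : ∀ i → Σ (Fin (#vertices Q)) λ j → (apply π (vtx Q j) ≗ₚ vtx P i) ×
    (∀ j′ → apply π (vtx Q j′) ≗ₚ vtx P i → j′ ≡ j)
  uniquePreimage i = τ i , hits , unique
    where
    hits : apply π (vtx Q (τ i)) ≗ₚ vtx P i
    hits r = trans (maps-vertices (τ i) r) (cong (λ i′ → vtx P i′ r) (σ∘τ i))
    unique : ∀ j′ → apply π (vtx Q j′) ≗ₚ vtx P i → j′ ≡ τ i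
    unique j′ hits′ = trans (sym (τ∘σ j′))
      (cong τ (vtx-injective P (λ r → trans (sym (maps-vertices j′ r)) (hits′ r))))

identityBijection : ∀ {p} (P : ZeroOnePolytope p) → VertexBijection P P identityMatrix
identityBijection P = record
  { σ = id ; τ = id ; σ∘τ = λ _ → refl ; τ∘σ = λ _ → refl
  ; maps-vertices = λ j → apply-identity (vtx P j) }

proper⇒missing : ∀ {m} (G : Subset m) → G ≢ ⊤ → ∃ λ j → j ∉ G
proper⇒missing G G≢⊤ with nonempty? (∁ G)
... | yes (j , j∈∁G) = j , x∈∁p⇒x∉p j∈∁G
... | no ∁G-empty = ⊥-elim (G≢⊤ (⊆-antisym ⊆⊤ (λ {x} _ → x∉∁p⇒x∈p (λ x∈∁G → ∁G-empty (x , x∈∁G)))))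

∈∁⁅⁆ : ∀ {m} {i j : Fin m} → j ≢ i → j ∈ ∁ ⁅ i ⁆
∈∁⁅⁆ j≢i = x∉p⇒x∈∁p (x≢y⇒x∉⁅y⁆ j≢i)

∈∁⁅⁆⇒≢ : ∀ {m} {i j : Fin m} → j ∈ ∁ ⁅ i ⁆ → j ≢ i
∈∁⁅⁆⇒≢ j∈∁⁅i⁆ = x∉⁅y⁆⇒x≢y (x∈∁p⇒x∉p j∈∁⁅i⁆)

∁⁅⁆-proper : ∀ {m} (i : Fin m) → ∁ ⁅ i ⁆ ≢ ⊤
∁⁅⁆-proper i ∁⁅i⁆≡⊤ = ∈∁⁅⁆⇒≢ (subst (i ∈_) (sym ∁⁅i⁆≡⊤) ∈⊤) refl

∁⁅⁆-injective : ∀ {m} {i j : Fin m} → ∁ ⁅ i ⁆ ≡ ∁ ⁅ j ⁆ → i ≡ j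
∁⁅⁆-injective {i = i} {j} eq with i ≟ j
... | yes i≡j = i≡j
... | no i≢j = ⊥-elim (∈∁⁅⁆⇒≢ (subst (i ∈_) (sym eq) (∈∁⁅⁆ i≢j)) refl)

proper⊆∁⁅⁆ : ∀ {m} (G : Subset m) → G ≢ ⊤ → ∃ λ i → G ⊆ ∁ ⁅ i ⁆
proper⊆∁⁅⁆ G G≢⊤ with proper⇒missing G G≢⊤
... | i , i∉G = i , λ j∈G → ∈∁⁅⁆ (λ { refl → i∉G j∈G })

∁⁅⁆-maximal : ∀ {m} (i : Fin m) (G : Subset m) → G ≢ ⊤ → ∁ ⁅ i ⁆ ⊆ G → G ≡ ∁ ⁅ i ⁆
∁⁅⁆-maximal i G G≢⊤ ∁⁅i⁆⊆G with proper⊆∁⁅⁆ G G≢⊤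
... | j , G⊆∁⁅j⁆ with i ≟ j
...   | yes refl = ⊆-antisym G⊆∁⁅j⁆ ∁⁅i⁆⊆G
...   | no i≢j = ⊥-elim (∈∁⁅⁆⇒≢ (G⊆∁⁅j⁆ (∁⁅i⁆⊆G (∈∁⁅⁆ (i≢j ∘ sym)))) refl)

unitVector : ∀ {n} → Fin n → Vec Bool n
unitVector a = Vec.tabulate (λ k → does (a ≟ k))

embed-unitVector : ∀ {n} (a k : Fin n) → embed (unitVector a) k ≡ δ a k
embed-unitVector a k = cong bool→ℚ (lookup∘tabulate (λ k → does (a ≟ k)) k)

unitVector-injective : ∀ {n} {a b : Fin n} → unitVector a ≡ unitVector b → a ≡ b
unitVector-injective {a = a} {b} eq with a ≟ b
... | yes a≡b = a≡b
... | no a≢b = ⊥-elim (1≢0 (begin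
  1ℚ                     ≡⟨ δ-diag a ⟨
  δ a a                  ≡⟨ embed-unitVector a a ⟨
  embed (unitVector a) a ≡⟨ cong (λ v → embed v a) eq ⟩
  embed (unitVector b) a ≡⟨ embed-unitVector b a ⟩
  δ b a                  ≡⟨ δ-off (a≢b ∘ sym) ⟩
  0ℚ                     ∎))
  where
  open ≡-Reasoning
  1≢0 : 1ℚ ≢ 0ℚ
  1≢0 ()

simplex : (n : ℕ) → ZeroOnePolytope n
simplex n = record { verts = List.tabulate unitVector ; distinct = tabulate⁺ unitVector-injective }

module Simplex (n : ℕ) where

  m : ℕ
  m = #vertices (simplex n)

  #vertices-simplex : m ≡ n
  #vertices-simplex = length-tabulate unitVector

  index : Fin m → Fin n
  index = cast #vertices-simplex

  index⁻¹ : Fin n → Fin m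
  index⁻¹ = cast (sym #vertices-simplex)

  index∘index⁻¹ : ∀ a → index (index⁻¹ a) ≡ a
  index∘index⁻¹ = cast-involutive #vertices-simplex (sym #vertices-simplex)

  index⁻¹∘index : ∀ j → index⁻¹ (index j) ≡ j
  index⁻¹∘index = cast-involutive (sym #vertices-simplex) #vertices-simplex

  vtx-simplex : ∀ j k → vtx (simplex n) j k ≡ δ (index j) k
  vtx-simplex j k = begin
    coordinate j                          ≡⟨ cong coordinate (index⁻¹∘index j) ⟨
    coordinate (index⁻¹ (index j))        ≡⟨ cong (λ v → embed v k) (lookup-tabulate unitVector (index j)) ⟩
    embed (unitVector (index j)) k        ≡⟨ embed-unitVector (index j) k ⟩
    δ (index j) k                         ∎
    where
    open ≡-Reasoning
    coordinate : Fin m → ℚ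
    coordinate j′ = vtx (simplex n) j′ k

  index-injective : ∀ {i j} → index i ≡ index j → i ≡ j
  index-injective {i} {j} eq = trans (sym (index⁻¹∘index i)) (trans (cong index⁻¹ eq) (index⁻¹∘index j))

  -- The facet opposite vertex i is cut out by the valid inequality x_{index i} ≥ 0,
  -- i.e. c · x ≤ 0 for the normal c = -e_{index i}.
  oppositeNormal : Fin m → Point n
  oppositeNormal i k = - δ (index i) k

  oppositeNormal·vtx : ∀ i j → (oppositeNormal i · vtx (simplex n) j) ≡ - δ (index i) (index j)
  oppositeNormal·vtx i j =
    trans (Σᶠ-cong (λ k → cong (oppositeNormal i k *_) (vtx-simplex j k))) (Σᶠ-δ (oppositeNormal i) (index j))

  tight-off : ∀ {i j} → j ≢ i → (oppositeNormal i · vtx (simplex n) j) ≡ 0ℚ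
  tight-off {i} {j} j≢i = trans (oppositeNormal·vtx i j) (cong -_ (δ-off (j≢i ∘ sym ∘ index-injective)))

  value-at : ∀ i → (oppositeNormal i · vtx (simplex n) i) ≡ - 1ℚ
  value-at i = trans (oppositeNormal·vtx i i) (cong -_ (δ-diag (index i)))

  opposite-face : ∀ i → IsFace (simplex n) (∁ ⁅ i ⁆)
  opposite-face i = oppositeNormal i , 0ℚ , valid , λ j → (λ j∈ → tight-off (∈∁⁅⁆⇒≢ j∈)) , tight⇒∈ j
    where
    -1≢0 : - 1ℚ ≢ 0ℚ
    -1≢0 ()
    valid : ∀ j → (oppositeNormal i · vtx (simplex n) j) ≤ℚ 0ℚ
    valid j with j ≟ i
    ... | yes refl = subst (_≤ℚ 0ℚ) (sym (value-at i)) (from-yes (- 1ℚ ℚP.≤? 0ℚ))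
    ... | no j≢i = ℚP.≤-reflexive (tight-off j≢i)
    tight⇒∈ : ∀ j → (oppositeNormal i · vtx (simplex n) j) ≡ 0ℚ → j ∈ ∁ ⁅ i ⁆
    tight⇒∈ j tight with j ≟ i
    ... | yes refl = ⊥-elim (-1≢0 (trans (sym (value-at i)) tight))
    ... | no j≢i = ∈∁⁅⁆ j≢i

  opposite-facet : ∀ i → IsFacet (simplex n) (∁ ⁅ i ⁆)
  opposite-facet i = opposite-face i , ∁⁅⁆-proper i , λ G _ G≢⊤ → ∁⁅⁆-maximal i G G≢⊤

  facet⇒opposite : ∀ F → IsFacet (simplex n) F → ∃ λ i → F ≡ ∁ ⁅ i ⁆
  facet⇒opposite F (_ , F≢⊤ , F-maximal) with proper⊆∁⁅⁆ F F≢⊤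
  ... | i , F⊆∁⁅i⁆ = i , sym (F-maximal (∁ ⁅ i ⁆) (opposite-face i) (∁⁅⁆-proper i) F⊆∁⁅i⁆)

  facetCount : FacetCount (simplex n) m
  facetCount = opposites , tabulate⁺ ∁⁅⁆-injective , (λ F → listed F , listed⁻¹ F) , length-tabulate (∁ ∘ ⁅_⁆)
    where
    opposites : List (Subset m)
    opposites = List.tabulate (∁ ∘ ⁅_⁆)
    listed : ∀ F → IsFacet (simplex n) F → F ∈ₗ opposites
    listed F facet with facet⇒opposite F facet
    ... | i , refl = ∈-tabulate⁺ i
    listed⁻¹ : ∀ F → F ∈ₗ opposites → IsFacet (simplex n) F
    listed⁻¹ F F∈ with ∈-tabulate⁻ F∈
    ... | i , refl = opposite-facet i

vertexMatrix : ∀ {p} (P : ZeroOnePolytope p) → Matrix p (#vertices P)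
vertexMatrix P r a = vtx P a r

simplexBijection : ∀ {p} (P : ZeroOnePolytope p) → VertexBijection P (simplex (#vertices P)) (vertexMatrix P)
simplexBijection P = record
  { σ = index ; τ = index⁻¹ ; σ∘τ = index∘index⁻¹ ; τ∘σ = index⁻¹∘index ; maps-vertices = maps-vertices }
  where
  open Simplex (#vertices P)
  maps-vertices : ∀ j → apply (vertexMatrix P) (vtx (simplex (#vertices P)) j) ≗ₚ vtx P (index j)
  maps-vertices j r =
    trans (Σᶠ-cong (λ k → cong (vtx P k r *_) (vtx-simplex j k))) (Σᶠ-δ (λ k → vtx P k r) (index j))

proposition2p3 : ∀ {p} (P : ZeroOnePolytope p) →
    (∀ k → FacetCount P k →
      Σ ℕ λ q → Σ (ZeroOnePolytope q) λ Q → Σ (Matrix p q) λ π →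
        NiceExt P Q π × Σ ℕ λ k′ → FacetCount Q k′ × k′ ≤ k)
    ×
    (Σ ℕ λ q → Σ (ZeroOnePolytope q) λ Q → Σ (Matrix p q) λ π →
        NiceExt P Q π × Σ ℕ λ k′ → FacetCount Q k′ × k′ ≤ #vertices P)
proposition2p3 P =
  (λ k facets → _ , P , identityMatrix , vertexBijection⇒nice (identityBijection P) , k , facets , ℕP.≤-refl)
  ,
  (_ , simplex (#vertices P) , vertexMatrix P , vertexBijection⇒nice (simplexBijection P)
     , m , facetCount , ℕP.≤-reflexive #vertices-simplex)
  where open Simplex (#vertices P)
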